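{- Let $(\mu_n)_{n\ge1}$ be an increasing sequence of positive integers such that $\mu_{n+1}>2\sum_{i=1}^n\mu_i$ for all $n\ge1$. Let $\mathbf{c}=1\,0^{\mu_1}\,1\,0^{\mu_2}\,1\,0^{\mu_3}\,1\cdots$ and let $S=\theta(\mathbf{c})=\{S_0<S_1<\cdots\}$ (so $S_0=1$). Then for every $n\ge1$, \[ S_n=\sum_{i=1}^n\mu_i+\frac{(n+1)(n+2)}{2}. \]
   Context: $0^{\mu}$ denotes a block of $\mu$ zeros. A set $S$ of positive integers is sum-free if there are no $x,y,z\in S$ ($x,y$ not necessarily distinct) with $x+y=z$. Cameron's bijection $\theta$: given a zero-one sequence $\mathbf{w}$, examine $n=1,2,3,\dots$ in order; if $n=x+y$ for some $x,y$ already placed in $S$ (possibly $x=y$), label $n$ by $\ast$ and $n\notin S$; otherwise read the next unread symbol of $\mathbf{w}$ and put $n\in S$ iff it is $1$. Then $\theta(\mathbf{w})=S$, listed increasingly as $S_0<S_1<\cdots$. -}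

module Defs where

open import Data.Nat using (ℕ; zero; suc; _+_; _*_; _∸_; _≡ᵇ_)
open import Data.Bool using (Bool; true; false; if_then_else_; _∧_)
open import Data.List using (List; []; _∷_; _++_; [_]; length; upTo)
open import Data.Bool.ListAction using (any)
open import Data.List.Membership.Propositional using (_∈_)
open import Data.Product using (_×_; _,_; proj₁; proj₂)
open import Relation.Binary.PropositionalEquality using (_≡_)

isSumOf : List ℕ → ℕ → Bool
isSumOf S n = any (λ x → any (λ y → (x + y) ≡ᵇ n) S) S

-- Cameron's procedure run on the integers 1..N for a zero-one sequence w
-- (w k = true means the k-th symbol, 0-indexed, is 1).
-- Returns (elements of θ(w) that are ≤ N, in increasing order ; number of symbols of w read so far).
run : (ℕ → Bool) → ℕ → List ℕ × ℕ
run w zero = [] , 0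
run w (suc N) with run w N
... | S , k =
  if isSumOf S (suc N) then (S , k)
  else (if w k then (S ++ [ suc N ] , suc k) else (S , suc k))

_∈θ_ : ℕ → (ℕ → Bool) → Set
n ∈θ w = n ∈ proj₁ (run w n)

countθ : (ℕ → Bool) → ℕ → ℕ
countθ w N = length (proj₁ (run w N))

-- S_k = m  (0-indexed increasing enumeration S_0 < S_1 < ... of θ(w)):
-- m ∈ θ(w) and exactly k elements of θ(w) are smaller than m.
IsNth : (ℕ → Bool) → ℕ → ℕ → Set
IsNth w k m = (m ∈θ w) × (countθ w (m ∸ 1) ≡ k)

sumμ : (ℕ → ℕ) → ℕ → ℕ
sumμ μ zero = 0
sumμ μ (suc n) = sumμ μ n + μ (suc n)

-- position (0-indexed) of the (j+1)-th symbol 1 in c = 1 0^{μ1} 1 0^{μ2} 1 ...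
onePos : (ℕ → ℕ) → ℕ → ℕ
onePos μ j = j + sumμ μ j

-- the sequence c = 1 0^{μ1} 1 0^{μ2} 1 0^{μ3} 1 ...  (onePos μ j ≥ j, so j ≤ p suffices)
cSeq : (ℕ → ℕ) → ℕ → Bool
cSeq μ p = any (λ j → onePos μ j ≡ᵇ p) (upTo (suc p))

-- While Cameron's procedure runs through the interval (S n, S (n+1)] of the sequence
-- c = 1 0^μ₁ 1 0^μ₂ 1 ..., the numbers it meets are of three kinds: the sums S n + S i
-- (i ≤ n) are skipped, all other numbers but the last read the block 0^μ₍ₙ₊₁₎ and are
-- rejected, and the last one reads the next 1.  This needs only 2 S n < S (n+1), so that
-- no other sum of two elements found so far lands in the interval; the growth condition
-- on μ guarantees it.  Counting the rejected numbers shows that the zeros run out exactly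
-- at S n + μ₍ₙ₊₁₎ + n + 1, so S (n+1) = S n + μ₍ₙ₊₁₎ + n + 2, and summing gives the formula.
module Submission where

open import Defs
open import Data.Nat using (ℕ; suc; _+_; _*_; _/_; _<_; _≤_)
open import Data.Nat using (zero; _∸_; _≤′_; ≤′-refl; ≤′-step; z≤n; s≤s; _≤?_)
open import Data.Nat.Properties
open import Data.Nat.DivMod using (m*n/n≡m)
open import Data.Nat.Tactic.RingSolver using (solve-∀)
open import Data.Bool using (Bool; true; false; T)
open import Data.Bool.Properties using (T-≡; ¬-not)
open import Data.Bool.ListAction using (any)
open import Data.List using (List; _++_; [_]; length; upTo; applyUpTo)
open import Data.List.Properties using (length-applyUpTo; applyUpTo-∷ʳ)
open import Data.List.Membership.Propositional using (_∈_; find; lose)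
open import Data.List.Membership.Propositional.Properties using (∈-upTo⁺; ∈-applyUpTo⁺; ∈-applyUpTo⁻)
open import Data.List.Relation.Unary.Any.Properties using (any⁺; any⁻)
open import Data.Product using (_×_; _,_; proj₁; ∃)
open import Data.Sum using (inj₁; inj₂)
open import Function.Bundles using (module Equivalence)
open import Relation.Nullary using (¬_; yes; no)
open import Relation.Binary.PropositionalEquality hiding ([_])

mono-≤ : (f : ℕ → ℕ) → (∀ n → f n ≤ f (suc n)) → ∀ {i j} → i ≤ j → f i ≤ f j
mono-≤ f step i≤j = go (≤⇒≤′ i≤j)
  where
  go : ∀ {i j} → i ≤′ j → f i ≤ f j
  go ≤′-refl        = ≤-refl
  go (≤′-step i≤′j) = ≤-trans (go i≤′j) (step _)

suc[a+b+c]≡a+[b+suc[c]] : ∀ a b c → suc (a + b + c) ≡ a + (b + suc c)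
suc[a+b+c]≡a+[b+suc[c]] = solve-∀

module _ {A : Set} (f : A → Bool) where

  any-true : ∀ {x xs} → x ∈ xs → T (f x) → any f xs ≡ true
  any-true x∈xs fx = Equivalence.to T-≡ (any⁺ f (lose x∈xs fx))

  any-witness : ∀ xs → any f xs ≡ true → ∃ λ x → x ∈ xs × T (f x)
  any-witness xs any≡true = find (any⁻ f xs (Equivalence.from T-≡ any≡true))

  any-false : ∀ xs → (∀ {x} → x ∈ xs → ¬ T (f x)) → any f xs ≡ false
  any-false xs h = ¬-not λ any≡true →
    let x , x∈xs , fx = any-witness xs any≡true in h x∈xs fx

isSumOf-true : ∀ {L a b} → a ∈ L → b ∈ L → isSumOf L (a + b) ≡ true
isSumOf-true {a = a} {b} a∈L b∈L =
  any-true _ a∈L (Equivalence.from T-≡ (any-true _ b∈L (≡⇒≡ᵇ (a + b) (a + b) refl)))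

isSumOf-false : ∀ {L n} → (∀ {a b} → a ∈ L → b ∈ L → a + b ≢ n) → isSumOf L n ≡ false
isSumOf-false {L} {n} h = any-false _ L λ {a} a∈L sum →
  let b , b∈L , a+b≡ᵇn = any-witness _ L (Equivalence.to T-≡ sum)
  in h a∈L b∈L (≡ᵇ⇒≡ (a + b) n a+b≡ᵇn)

module _ (w : ℕ → Bool) {N L k} (run≡ : run w N ≡ (L , k)) where

  run-suc-sum : isSumOf L (suc N) ≡ true → run w (suc N) ≡ (L , k)
  run-suc-sum sum rewrite run≡ | sum = refl

  run-suc-rejected : isSumOf L (suc N) ≡ false → w k ≡ false → run w (suc N) ≡ (L , suc k)
  run-suc-rejected notSum reads0 rewrite run≡ | notSum | reads0 = refl

  run-suc-accepted : isSumOf L (suc N) ≡ false → w k ≡ true → run w (suc N) ≡ (L ++ [ suc N ] , suc k)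
  run-suc-accepted notSum one rewrite run≡ | notSum | one = refl

run-+-rejected : ∀ w {A L k} D → run w A ≡ (L , k) →
  (∀ {d} → d < D → isSumOf L (suc (A + d)) ≡ false) →
  (∀ {d} → d < D → w (k + d) ≡ false) →
  run w (A + D) ≡ (L , k + D)
run-+-rejected w {A} {k = k} zero run≡ _ _ rewrite +-identityʳ A | +-identityʳ k = run≡
run-+-rejected w {A} {k = k} (suc D) run≡ notSum reads0 rewrite +-suc A D | +-suc k D =
  run-suc-rejected w
    (run-+-rejected w D run≡ (λ d<D → notSum (m<n⇒m<1+n d<D)) (λ d<D → reads0 (m<n⇒m<1+n d<D)))
    (notSum ≤-refl) (reads0 ≤-refl)

triangle : ℕ → ℕ
triangle zero    = 1
triangle (suc n) = triangle n + suc (suc n)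

triangle*2 : ∀ n → triangle n * 2 ≡ (n + 1) * (n + 2)
triangle*2 zero    = refl
triangle*2 (suc n) = begin
  (triangle n + suc (suc n)) * 2        ≡⟨ *-distribʳ-+ 2 (triangle n) (suc (suc n)) ⟩
  triangle n * 2 + suc (suc n) * 2      ≡⟨ cong (_+ suc (suc n) * 2) (triangle*2 n) ⟩
  (n + 1) * (n + 2) + suc (suc n) * 2   ≡⟨ step n ⟩
  (suc n + 1) * (suc n + 2)             ∎
  where
  open ≡-Reasoning
  step : ∀ n → (n + 1) * (n + 2) + suc (suc n) * 2 ≡ (suc n + 1) * (suc n + 2)
  step = solve-∀

triangle≡ : ∀ n → triangle n ≡ (n + 1) * (n + 2) / 2
triangle≡ n = trans (sym (m*n/n≡m (triangle n) 2)) (cong (_/ 2) (triangle*2 n))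

module _ (μ : ℕ → ℕ) where

  gap : ℕ → ℕ
  gap n = μ (suc n) + suc n

  S : ℕ → ℕ
  S zero    = 1
  S (suc n) = S n + suc (gap n)

  prefix : ℕ → List ℕ
  prefix n = applyUpTo S (suc n)

  -- the number of zeros of c read between S n and S n + S i, for i ≤ n
  zerosUpTo : ℕ → ℕ
  zerosUpTo zero    = 0
  zerosUpTo (suc i) = zerosUpTo i + gap i

  S-mono : ∀ {i j} → i ≤ j → S i ≤ S j
  S-mono = mono-≤ S λ n → m≤m+n (S n) _

  zerosUpTo-mono : ∀ {i j} → i ≤ j → zerosUpTo i ≤ zerosUpTo j
  zerosUpTo-mono = mono-≤ zerosUpTo λ n → m≤m+n (zerosUpTo n) (gap n)

  S≡suc[zerosUpTo+n] : ∀ n → S n ≡ suc (zerosUpTo n + n)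
  S≡suc[zerosUpTo+n] zero    = refl
  S≡suc[zerosUpTo+n] (suc n) rewrite S≡suc[zerosUpTo+n] n = shuffle (zerosUpTo n) (gap n) n
    where
    shuffle : ∀ z g n → suc (z + n) + suc g ≡ suc (z + g + suc n)
    shuffle = solve-∀

  S≡sumμ+triangle : ∀ n → S n ≡ sumμ μ n + triangle n
  S≡sumμ+triangle zero    = refl
  S≡sumμ+triangle (suc n) rewrite S≡sumμ+triangle n = shuffle (sumμ μ n) (μ (suc n)) (triangle n) n
    where
    shuffle : ∀ s m t n → s + t + suc (m + suc n) ≡ s + m + (t + suc (suc n))
    shuffle = solve-∀

  S-between : ∀ {i x} → S i < x → x < S (suc i) → ∀ b → S b ≢ x
  S-between {i} Si<x x<Ssi b refl with b ≤? i
  ... | yes b≤i = <-irrefl refl (≤-<-trans (S-mono b≤i) Si<x)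
  ... | no  b≰i = <-irrefl refl (<-≤-trans x<Ssi (S-mono (≰⇒> b≰i)))

  S-above : ∀ {n x b} → b ≤ n → S n < x → S b ≢ x
  S-above b≤n Sn<x refl = <-irrefl refl (≤-<-trans (S-mono b≤n) Sn<x)

  onePos-suc : ∀ n → onePos μ (suc n) ≡ suc (onePos μ n + μ (suc n))
  onePos-suc n = cong suc (sym (+-assoc n (sumμ μ n) (μ (suc n))))

  onePos-mono : ∀ {i j} → i ≤ j → onePos μ i ≤ onePos μ j
  onePos-mono = mono-≤ (onePos μ) λ n →
    subst (onePos μ n ≤_) (sym (onePos-suc n)) (m≤n⇒m≤1+n (m≤m+n (onePos μ n) (μ (suc n))))

  cSeq-onePos : ∀ j → cSeq μ (onePos μ j) ≡ true
  cSeq-onePos j = any-true _ (∈-upTo⁺ (s≤s (m≤m+n j (sumμ μ j)))) (≡⇒≡ᵇ (onePos μ j) (onePos μ j) refl)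

  cSeq-zeros : ∀ n {z} → z < μ (suc n) → cSeq μ (suc (onePos μ n) + z) ≡ false
  cSeq-zeros n {z} z<μ = any-false _ (upTo (suc (suc (onePos μ n) + z))) λ {j} _ onePos≡ᵇ → onePos≢ j (≡ᵇ⇒≡ _ _ onePos≡ᵇ)
    where
    onePos≢ : ∀ j → onePos μ j ≢ suc (onePos μ n) + z
    onePos≢ j eq with j ≤? n
    ... | yes j≤n = <-irrefl eq (s≤s (≤-trans (onePos-mono j≤n) (m≤m+n (onePos μ n) z)))
    ... | no  j≰n = <-irrefl (sym eq) (begin-strict
      suc (onePos μ n + z)            <⟨ s≤s (+-monoʳ-< (onePos μ n) z<μ) ⟩
      suc (onePos μ n + μ (suc n))    ≡⟨ onePos-suc n ⟨
      onePos μ (suc n)                ≤⟨ onePos-mono (≰⇒> j≰n) ⟩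
      onePos μ j                      ∎)
      where open ≤-Reasoning

  triangle≤sumμ+suc : (∀ i → suc i ≤ μ (suc i)) → ∀ n → triangle n ≤ sumμ μ n + suc n
  triangle≤sumμ+suc μ≥ zero    = ≤-refl
  triangle≤sumμ+suc μ≥ (suc n) =
    +-monoˡ-≤ (suc (suc n)) (≤-trans (triangle≤sumμ+suc μ≥ n) (+-monoʳ-≤ (sumμ μ n) (μ≥ n)))

  S≤gap-of-lacunary :
    (∀ n → 1 ≤ n → 0 < μ n) →
    (∀ n → 1 ≤ n → μ n < μ (suc n)) →
    (∀ n → 1 ≤ n → 2 * sumμ μ n < μ (suc n)) →
    ∀ n → S n ≤ gap n
  S≤gap-of-lacunary μ-pos μ-inc μ-lacunary zero    = m≤n+m 1 (μ 1)
  S≤gap-of-lacunary μ-pos μ-inc μ-lacunary (suc p) = begin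
    S n                               ≡⟨ S≡sumμ+triangle n ⟩
    sumμ μ n + triangle n             ≤⟨ +-monoʳ-≤ (sumμ μ n) (triangle≤sumμ+suc μ≥ n) ⟩
    sumμ μ n + (sumμ μ n + suc n)     ≡⟨ double (sumμ μ n) (suc n) ⟩
    2 * sumμ μ n + suc n              ≤⟨ +-monoˡ-≤ (suc n) (<⇒≤ (μ-lacunary n (s≤s z≤n))) ⟩
    gap n                             ∎
    where
    open ≤-Reasoning
    n = suc p
    μ≥ : ∀ i → suc i ≤ μ (suc i)
    μ≥ zero    = μ-pos 1 ≤-refl
    μ≥ (suc i) = ≤-trans (s≤s (μ≥ i)) (μ-inc (suc i) (s≤s z≤n))
    double : ∀ s k → s + (s + k) ≡ 2 * s + k
    double = solve-∀

  module _ (S≤gap : ∀ n → S n ≤ gap n) where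

    S+S<S : ∀ {i j n} → i < n → j < n → S i + S j < S n
    S+S<S {i} {j} {suc p} (s≤s i≤p) (s≤s j≤p) = begin-strict
      S i + S j        ≤⟨ +-mono-≤ (S-mono i≤p) (S-mono j≤p) ⟩
      S p + S p        ≤⟨ +-monoʳ-≤ (S p) (S≤gap p) ⟩
      S p + gap p      <⟨ +-monoʳ-< (S p) ≤-refl ⟩
      S p + suc (gap p) ∎
      where open ≤-Reasoning

    isSumOf-prefix-true : ∀ n {i} → i ≤ n → isSumOf (prefix n) (S n + S i) ≡ true
    isSumOf-prefix-true n i≤n = isSumOf-true (∈-applyUpTo⁺ S ≤-refl) (∈-applyUpTo⁺ S (s≤s i≤n))

    -- Either summand S n leaves x = S b; otherwise both are earlier and the sum falls short of S n.
    isSumOf-prefix-false : ∀ n {x} → (∀ {b} → b ≤ n → S b ≢ x) → isSumOf (prefix n) (S n + x) ≡ false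
    isSumOf-prefix-false n {x} x∉S = isSumOf-false λ a∈ b∈ → sum≢ (∈-applyUpTo⁻ S a∈) (∈-applyUpTo⁻ S b∈)
      where
      sum≢ : ∀ {a b} → ∃ (λ i → i < suc n × a ≡ S i) → ∃ (λ j → j < suc n × b ≡ S j) → a + b ≢ S n + x
      sum≢ (i , s≤s i≤n , refl) (j , s≤s j≤n , refl) eq
        with m≤n⇒m<n∨m≡n i≤n | m≤n⇒m<n∨m≡n j≤n
      ... | _         | inj₂ refl = x∉S i≤n (+-cancelʳ-≡ (S n) (S i) x (trans eq (+-comm (S n) x)))
      ... | inj₂ refl | inj₁ _    = x∉S j≤n (+-cancelˡ-≡ (S n) (S j) x eq)
      ... | inj₁ i<n  | inj₁ j<n  = <-irrefl eq (<-≤-trans (S+S<S i<n j<n) (m≤m+n (S n) x))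

    zerosUpTo+rest : ∀ n → zerosUpTo n + (gap n ∸ S n) ≡ μ (suc n)
    zerosUpTo+rest n = +-cancelˡ-≡ (suc n) _ _ (begin
      suc n + (zerosUpTo n + rest)   ≡⟨ shuffle (zerosUpTo n) rest n ⟩
      suc (zerosUpTo n + n) + rest   ≡⟨ cong (_+ rest) (S≡suc[zerosUpTo+n] n) ⟨
      S n + rest                     ≡⟨ m+[n∸m]≡n (S≤gap n) ⟩
      μ (suc n) + suc n              ≡⟨ +-comm (μ (suc n)) (suc n) ⟩
      suc n + μ (suc n)              ∎)
      where
      open ≡-Reasoning
      rest = gap n ∸ S n
      shuffle : ∀ z r n → suc n + (z + r) ≡ suc (z + n) + r
      shuffle = solve-∀

    zerosUpTo≤μ : ∀ n → zerosUpTo n ≤ μ (suc n)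
    zerosUpTo≤μ n = subst (zerosUpTo n ≤_) (zerosUpTo+rest n) (m≤m+n (zerosUpTo n) _)

    run-S+S : ∀ n → run (cSeq μ) (S n) ≡ (prefix n , suc (onePos μ n)) →
      ∀ {i} → i ≤ n → run (cSeq μ) (S n + S i) ≡ (prefix n , suc (onePos μ n) + zerosUpTo i)
    run-S+S n run≡ {zero} _ rewrite +-comm (S n) 1 | +-identityʳ (onePos μ n) =
      run-suc-sum (cSeq μ) run≡ (subst (λ m → isSumOf (prefix n) m ≡ true) (+-comm (S n) 1) (isSumOf-prefix-true n z≤n))
    run-S+S n run≡ {suc i} si≤n = begin
      run (cSeq μ) (S n + S (suc i))       ≡⟨ cong (run (cSeq μ)) (suc[a+b+c]≡a+[b+suc[c]] (S n) (S i) (gap i)) ⟨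
      run (cSeq μ) (suc (S n + S i + gap i)) ≡⟨ run-suc-sum (cSeq μ) rejected sum ⟩
      (prefix n , suc (onePos μ n) + zerosUpTo i + gap i) ≡⟨ cong (prefix n ,_) (+-assoc (suc (onePos μ n)) (zerosUpTo i) (gap i)) ⟩
      (prefix n , suc (onePos μ n) + zerosUpTo (suc i)) ∎
      where
      open ≡-Reasoning
      rejected = run-+-rejected (cSeq μ) (gap i) (run-S+S n run≡ (≤-trans (n≤1+n i) si≤n))
        (λ {d} d<gap → subst (λ m → isSumOf (prefix n) m ≡ false) (sym (suc[a+b+c]≡a+[b+suc[c]] (S n) (S i) d))
          (isSumOf-prefix-false n (λ {b} _ → S-between (m<m+n (S i) (s≤s z≤n)) (+-monoʳ-< (S i) (s≤s d<gap)) b)))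
        (λ {d} d<gap → subst (λ m → cSeq μ m ≡ false) (sym (+-assoc (suc (onePos μ n)) (zerosUpTo i) d))
          (cSeq-zeros n (<-≤-trans (+-monoʳ-< (zerosUpTo i) d<gap) (≤-trans (zerosUpTo-mono si≤n) (zerosUpTo≤μ n)))))
      sum = subst (λ m → isSumOf (prefix n) m ≡ true) (sym (suc[a+b+c]≡a+[b+suc[c]] (S n) (S i) (gap i)))
        (isSumOf-prefix-true n si≤n)

    run-before-S : ∀ n → run (cSeq μ) (S n) ≡ (prefix n , suc (onePos μ n)) →
      run (cSeq μ) (S n + gap n) ≡ (prefix n , onePos μ (suc n))
    run-before-S n run≡ = begin
      run (cSeq μ) (S n + gap n)                ≡⟨ cong (λ g → run (cSeq μ) (S n + g)) (m+[n∸m]≡n (S≤gap n)) ⟨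
      run (cSeq μ) (S n + (S n + rest))         ≡⟨ cong (run (cSeq μ)) (+-assoc (S n) (S n) rest) ⟨
      run (cSeq μ) (S n + S n + rest)           ≡⟨ rejected ⟩
      (prefix n , suc (onePos μ n) + zerosUpTo n + rest) ≡⟨ cong (prefix n ,_) read ⟩
      (prefix n , onePos μ (suc n))             ∎
      where
      open ≡-Reasoning
      rest = gap n ∸ S n
      rejected = run-+-rejected (cSeq μ) rest (run-S+S n run≡ ≤-refl)
        (λ {d} _ → subst (λ m → isSumOf (prefix n) m ≡ false) (sym (suc[a+b+c]≡a+[b+suc[c]] (S n) (S n) d))
          (isSumOf-prefix-false n (λ b≤n → S-above b≤n (m<m+n (S n) (s≤s z≤n)))))
        (λ {d} d<rest → subst (λ m → cSeq μ m ≡ false) (sym (+-assoc (suc (onePos μ n)) (zerosUpTo n) d))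
          (cSeq-zeros n (subst (zerosUpTo n + d <_) (zerosUpTo+rest n) (+-monoʳ-< (zerosUpTo n) d<rest))))
      read : suc (onePos μ n) + zerosUpTo n + rest ≡ onePos μ (suc n)
      read = trans (+-assoc (suc (onePos μ n)) (zerosUpTo n) rest)
        (trans (cong (λ z → suc (onePos μ n + z)) (zerosUpTo+rest n)) (sym (onePos-suc n)))

    run-S : ∀ n → run (cSeq μ) (S n) ≡ (prefix n , suc (onePos μ n))
    run-S zero    = refl
    run-S (suc n) = begin
      run (cSeq μ) (S (suc n))                                ≡⟨ cong (run (cSeq μ)) (+-suc (S n) (gap n)) ⟩
      run (cSeq μ) (suc (S n + gap n))                        ≡⟨ run-suc-accepted (cSeq μ) (run-before-S n (run-S n)) notSum (cSeq-onePos (suc n)) ⟩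
      (prefix n ++ [ suc (S n + gap n) ] , suc (onePos μ (suc n))) ≡⟨ cong (λ m → (prefix n ++ [ m ] , suc (onePos μ (suc n)))) (+-suc (S n) (gap n)) ⟨
      (prefix n ++ [ S (suc n) ] , suc (onePos μ (suc n)))    ≡⟨ cong (_, suc (onePos μ (suc n))) (applyUpTo-∷ʳ S (suc n)) ⟩
      (prefix (suc n) , suc (onePos μ (suc n)))               ∎
      where
      open ≡-Reasoning
      notSum = subst (λ m → isSumOf (prefix n) m ≡ false) (+-suc (S n) (gap n))
        (isSumOf-prefix-false n (λ b≤n → S-above b≤n (s≤s (S≤gap n))))

    S-isNth : ∀ n → IsNth (cSeq μ) n (S n)
    S-isNth n = subst (λ r → S n ∈ proj₁ r) (sym (run-S n)) (∈-applyUpTo⁺ S ≤-refl) , count n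
      where
      count : ∀ n → countθ (cSeq μ) (S n ∸ 1) ≡ n
      count zero    = refl
      count (suc n) = begin
        countθ (cSeq μ) (S (suc n) ∸ 1)   ≡⟨ cong (λ m → countθ (cSeq μ) (m ∸ 1)) (+-suc (S n) (gap n)) ⟩
        countθ (cSeq μ) (S n + gap n)     ≡⟨ cong (λ r → length (proj₁ r)) (run-before-S n (run-S n)) ⟩
        length (prefix n)                 ≡⟨ length-applyUpTo S (suc n) ⟩
        suc n                             ∎
        where open ≡-Reasoning

mainTheorem10 : (μ : ℕ → ℕ) →
    (∀ n → 1 ≤ n → 0 < μ n) →
    (∀ n → 1 ≤ n → μ n < μ (suc n)) →
    (∀ n → 1 ≤ n → 2 * sumμ μ n < μ (suc n)) →
    ∀ n → 1 ≤ n → IsNth (cSeq μ) n (sumμ μ n + ((n + 1) * (n + 2)) / 2)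
mainTheorem10 μ μ-pos μ-inc μ-lacunary n _ =
  subst (IsNth (cSeq μ) n) S≡formula (S-isNth μ (S≤gap-of-lacunary μ μ-pos μ-inc μ-lacunary) n)
  where
  S≡formula : S μ n ≡ sumμ μ n + ((n + 1) * (n + 2)) / 2
  S≡formula = trans (S≡sumμ+triangle μ n) (cong (sumμ μ n +_) (triangle≡ n))
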